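{- Let $\sigma,k\ge2$ and $\pi,\rho\in\mathbb{U}_{\sigma,k}$. If there exist indices $i\in[0..|\rho|-1]$, $j\in[0..|\pi|-1]$ and $\varepsilon>0$ such that $C_{\mathcal{W}_{\pi,j}}(n)-C_{\mathcal{W}_{\rho,i}}(n)=\Omega((\alpha_{\rho,i+1}+\varepsilon)^n)$ as $n\to\infty$, then $\rho\triangleleft\pi$.
   Context: $\Sigma=\{0,\dots,\sigma-1\}$; a $k$-mer is a string of length $k$; $s$ avoids $t$ if $t$ is not a substring of $s$. An arrangement of $\Sigma^k$ is a sequence $\rho$ of distinct $k$-mers, $\rho[j]$ having rank $j$; its domain is the set of its entries. The domain $U$ is a universal hitting set (UHS) for $w$ if every string of length $w+k-1$ contains a $k$-mer of $U$ (then also for all larger $w$); $\mathbb{U}_{\sigma,k}$ is the set of arrangements whose domain is a UHS for some $w$. For $\rho$ whose domain is a UHS for $w$, the minimizer $(\rho,w)$ selects, in each length-$(w+k-1)$ window of a string, the starting position of the leftmost occurrence of the minimum-rank $k$-mer of the domain occurring in the window; its density $d_{(\rho,w)}$ is the limiting expected fraction of selected positions in a uniformly random string, equivalently the fraction of strings $v\in\Sigma^{w+k}$ whose minimum-rank domain $k$-mer is its length-$k$ prefix or its length-$k$ suffix occurring only once in $v$. For $\rho,\rho'\in\mathbb{U}_{\sigma,k}$, $\rho\triangleleft\rho'$ means there is $w_0$ such that $d_{(\rho,w)}<d_{(\rho',w)}$ for all $w\ge w_0$. $\mathcal{L}_{\rho,j}$ is the set of strings avoiding $\rho[1],\dots,\rho[j]$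 and $\alpha_{\rho,j}=\limsup_n|\mathcal{L}_{\rho,j}\cap\Sigma^n|^{1/n}$. $\mathcal{P}_{\rho,j}$: strings of length $\ge k$ with length-$k$ prefix $\rho[j]$ avoiding $\rho[1],\dots,\rho[j-1]$; $\mathcal{S}_{\rho,j}$: strings of length $\ge k$ with length-$k$ suffix $\rho[j]$, having no other occurrence of $\rho[j]$, avoiding $\rho[1],\dots,\rho[j-1]$. For $i\in[0..|\rho|-1]$, $\mathcal{W}_{\rho,i}=\bigcup_{j=1}^{i+1}\mathcal{P}_{\rho,j}\cup\bigcup_{j=1}^{i}\mathcal{S}_{\rho,j}$. $C_L(n)=|L\cap\Sigma^n|$. -}

module Defs where

open import Data.Nat as ℕ using (ℕ; zero; suc; _+_; _∸_; _≤_; _<_; _≥_)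
open import Data.Fin using (Fin)
open import Data.Fin.Properties using () renaming (_≟_ to _≟F_)
open import Data.Bool using (Bool; true; false; _∧_; _∨_; not; if_then_else_)
open import Data.List using (List; []; _∷_; length; take; drop; filter; map; concatMap; allFin; upTo; reverse)
open import Data.Bool.ListAction using (any; all)
open import Data.List.Properties using (≡-dec)
open import Data.List.Relation.Unary.All using (All)
open import Data.List.Relation.Unary.Unique.Propositional using (Unique)
open import Data.List.Membership.Propositional using (_∈_)
open import Data.Maybe using (Maybe; just; nothing)
open import Data.Product using (Σ; _×_; ∃; ∃-syntax; _,_)
open import Data.Integer using (ℤ; +_)
open import Data.Rational as ℚ using (ℚ; 0ℚ; 1ℚ; _/_; _*_; _-_)
open import Relation.Nullary.Decidable using (⌊_⌋)
open import Relation.Binary.PropositionalEquality using (_≡_)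

Str : ℕ → Set
Str σ = List (Fin σ)

_==_ : ∀ {σ} → Str σ → Str σ → Bool
s == t = ⌊ ≡-dec _≟F_ s t ⌋

allStrings : (σ n : ℕ) → List (Str σ)
allStrings σ zero    = [] ∷ []
allStrings σ (suc n) = concatMap (λ a → map (a ∷_) (allStrings σ n)) (allFin σ)

windows : ∀ {σ} → ℕ → Str σ → List (Str σ)
windows m [] = if ⌊ m ℕ.≟ 0 ⌋ then [] ∷ [] else []
windows m (a ∷ s) with ⌊ m ℕ.≤? length (a ∷ s) ⌋
... | true  = take m (a ∷ s) ∷ windows m s
... | false = []

occurrences : ∀ {σ} → Str σ → Str σ → ℕ
occurrences t s = length (filter (λ u → ≡-dec _≟F_ u t) (windows (length t) s))

occurs : ∀ {σ} → Str σ → Str σ → Bool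
occurs t s = any (_== t) (windows (length t) s)

avoidsAll : ∀ {σ} → List (Str σ) → Str σ → Bool
avoidsAll ts s = all (λ t → not (occurs t s)) ts

suffix : ∀ {σ} → ℕ → Str σ → Str σ
suffix m s = drop (length s ∸ m) s

-- An arrangement of Σ^k: a list of distinct k-mers; ρ[j] is the entry
-- at 1-indexed position j (rank j).
record Arrangement (σ k : ℕ) : Set where
  constructor arr
  field
    seq      : List (Str σ)
    kmers    : All (λ x → length x ≡ k) seq
    distinct : Unique seq
open Arrangement public

size : ∀ {σ k} → Arrangement σ k → ℕ
size ρ = length (seq ρ)

entry : ∀ {σ k} → Arrangement σ k → ℕ → Maybe (Str σ)
entry ρ zero    = nothing
entry ρ (suc j) with drop j (seq ρ)
... | []    = nothing
... | x ∷ _ = just x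

firsts : ∀ {σ k} → Arrangement σ k → ℕ → List (Str σ)
firsts ρ j = take j (seq ρ)

IsUHS : ∀ {σ k} → Arrangement σ k → ℕ → Set
IsUHS {σ} {k} ρ w = (s : Str σ) → length s ≡ w + k ∸ 1 → ∃[ x ] (x ∈ seq ρ × occurs x s ≡ true)

InU : ∀ {σ k} → Arrangement σ k → Set
InU ρ = ∃[ w ] IsUHS ρ w

minKmer : ∀ {σ} → List (Str σ) → Str σ → Maybe (Str σ)
minKmer []       v = nothing
minKmer (x ∷ xs) v = if occurs x v then just x else minKmer xs v

charged : ∀ {σ k} → Arrangement σ k → Str σ → Bool
charged {σ} {k} ρ v with minKmer (seq ρ) v
... | nothing = false
... | just x  = (x == take k v) ∨ ((x == suffix k v) ∧ ⌊ occurrences x v ℕ.≟ 1 ⌋)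

-- a / d as a rational (d = 0 never arises below since σ ≥ 2).
frac : ℕ → ℕ → ℚ
frac a zero    = 0ℚ
frac a (suc d) = (+ a) / suc d

density : ∀ {σ k} → Arrangement σ k → ℕ → ℚ
density {σ} {k} ρ w =
  frac (length (filter (λ v → charged ρ v ≡? true) (allStrings σ (w + k)))) (σ ℕ.^ (w + k))
  where
  open import Data.Bool.Properties using () renaming (_≟_ to _≡?_)

_◁_ : ∀ {σ k} → Arrangement σ k → Arrangement σ k → Set
ρ ◁ ρ' = ∃[ w₀ ] ((w : ℕ) → w ≥ w₀ → density ρ w ℚ.< density ρ' w)

Lang : ℕ → Set
Lang σ = Str σ → Bool

C : ∀ {σ} → Lang σ → ℕ → ℕ
C {σ} L n = length (filter (λ s → L s ≡? true) (allStrings σ n))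
  where
  open import Data.Bool.Properties using () renaming (_≟_ to _≡?_)

𝓛 : ∀ {σ k} → Arrangement σ k → ℕ → Lang σ
𝓛 ρ j s = avoidsAll (firsts ρ j) s

𝓟 : ∀ {σ k} → Arrangement σ k → ℕ → Lang σ
𝓟 {k = k} ρ j s with entry ρ j
... | nothing = false
... | just x  = ⌊ k ℕ.≤? length s ⌋ ∧ (take k s == x) ∧ avoidsAll (firsts ρ (j ∸ 1)) s

𝓢 : ∀ {σ k} → Arrangement σ k → ℕ → Lang σ
𝓢 {k = k} ρ j s with entry ρ j
... | nothing = false
... | just x  = ⌊ k ℕ.≤? length s ⌋ ∧ (suffix k s == x) ∧ ⌊ occurrences x s ℕ.≟ 1 ⌋
                ∧ avoidsAll (firsts ρ (j ∸ 1)) s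

𝓦 : ∀ {σ k} → Arrangement σ k → ℕ → Lang σ
𝓦 ρ i s = any (λ j → 𝓟 ρ (suc j) s) (upTo (suc i)) ∨ any (λ j → 𝓢 ρ (suc j) s) (upTo i)

_^ℚ_ : ℚ → ℕ → ℚ
q ^ℚ zero  = 1ℚ
q ^ℚ suc n = q * (q ^ℚ n)

-- α_L < β, where α_L = limsup_n C_L(n)^{1/n}.  Unfolding the limsup:
-- α_L < β iff there is β' with 0 ≤ β' < β and C_L(n) ≤ β'^n for all large n.
GrowthBelow : ∀ {σ} → Lang σ → ℚ → Set
GrowthBelow L β = ∃[ β' ] (0ℚ ℚ.≤ β' × β' ℚ.< β ×
  ∃[ N ] ((n : ℕ) → n ≥ N → ((+ C L n) / 1) ℚ.≤ (β' ^ℚ n)))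

BigΩPow : (ℕ → ℚ) → ℚ → Set
BigΩPow f β = ∃[ c ] (0ℚ ℚ.< c × ∃[ N ] ((n : ℕ) → n ≥ N → c * (β ^ℚ n) ℚ.≤ f n))

diffW : ∀ {σ k} → Arrangement σ k → ℕ → Arrangement σ k → ℕ → ℕ → ℚ
diffW π j ρ i n = ((+ C (𝓦 π j) n) / 1) - ((+ C (𝓦 ρ i) n) / 1)

{-# OPTIONS --safe #-}
-- Write n = w + k.  A string v ∈ Σⁿ charged for ρ either lies in 𝓦_{ρ,i}, or its minimal k-mer
-- has rank > i + 1, so that v ∈ 𝓛_{ρ,i+1}, or that k-mer has rank i + 1 and is the unique
-- occurrence at the end of v, so that v minus its last letter lies in 𝓛_{ρ,i+1}.  Conversely
-- every string of 𝓦_{π,j} is charged for π.  Hence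
--   σⁿ (d_π − d_ρ) ≥ C_{𝓦_{π,j}}(n) − C_{𝓦_{ρ,i}}(n) − C_{𝓛_{ρ,i+1}}(n) − σ C_{𝓛_{ρ,i+1}}(n − 1),
-- and the hypotheses bound the right-hand side from below by c βⁿ − β′ⁿ − σ β′ⁿ⁻¹ with β′ < β,
-- which is positive for large n by Bernoulli's inequality and the Archimedean property.
module Submission where

open import Defs
open import Data.Nat as ℕ using (ℕ; zero; suc; z≤n; s≤s)
import Data.Nat.Properties as ℕP
open import Data.Nat.ListAction using (sum)
open import Data.Rational as ℚ using (ℚ; mkℚ; 0ℚ; 1ℚ; -_; ↥_; 1/_; _/_)
import Data.Rational.Properties as ℚP
open import Data.Rational.Solver using (module +-*-Solver)
open import Data.Fin using (Fin)
open import Data.Fin.Properties using () renaming (_≟_ to _≟F_)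
open import Data.Bool using (Bool; true; false; T; not; _∧_; _∨_)
open import Data.Bool.Properties using (T-∧; T-∨) renaming (_≟_ to _≟B_)
open import Data.Bool.ListAction using (any)
open import Data.List using (List; []; _∷_; _++_; _∷ʳ_; length; take; drop; filter; map; concat; allFin; upTo)
open import Data.List.Properties
  using (≡-dec; map-cong; map-∘; length-tabulate; length-++; length-take; filter-++; filter-accept; filter-some;
         take-take; take-all)
open import Data.List.Membership.Propositional using (_∈_; lose)
open import Data.List.Membership.Propositional.Properties using (∈-++⁺ˡ; ∈-filter⁻; ∈-upTo⁺)
open import Data.List.Relation.Unary.Any as Any using (here)
open import Data.List.Relation.Unary.Any.Properties using (any⁺; any⁻)
open import Data.List.Relation.Unary.All as All using (All; []; _∷_)
open import Data.List.Relation.Unary.All.Properties using (all⁺; all⁻; ∷ʳ⁺; take⁺; drop⁺; map⁺; concat⁺)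
open import Data.Maybe using (just)
open import Data.Sum as Sum using (_⊎_; inj₁; inj₂)
open import Data.Product using (∃-syntax; _×_; _,_; proj₁; proj₂)
open import Function using (Equivalence; _∘_; id)
open import Relation.Nullary using (¬_; yes; no; contradiction)
open import Relation.Nullary.Decidable using (⌊_⌋; toWitness; fromWitness)
open import Relation.Binary.PropositionalEquality
  using (_≡_; refl; sym; trans; cong; cong₂; subst; subst₂; module ≡-Reasoning)

Eventually : (ℕ → Set) → Set
Eventually P = ∃[ N ] (∀ n → N ℕ.≤ n → P n)

eventually-mono : ∀ {P Q : ℕ → Set} → (∀ n → P n → Q n) → Eventually P → Eventually Q
eventually-mono P⇒Q (N , p) = N , λ n N≤n → P⇒Q n (p n N≤n)

eventually-× : ∀ {P Q : ℕ → Set} → Eventually P → Eventually Q → Eventually (λ n → P n × Q n)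
eventually-× (M , p) (N , q) =
  M ℕ.⊔ N , λ n M⊔N≤n → p n (ℕP.≤-trans (ℕP.m≤m⊔n M N) M⊔N≤n) , q n (ℕP.≤-trans (ℕP.m≤n⊔m M N) M⊔N≤n)

eventually-suc : ∀ {P : ℕ → Set} → Eventually P → Eventually (P ∘ suc)
eventually-suc (N , p) = N , λ n N≤n → p (suc n) (ℕP.m≤n⇒m≤1+n N≤n)

module _ where

  open import Data.Rational using (_+_; _*_; _-_; _≤_; _<_)
  open import Data.Integer as ℤ using (+_; -[1+_])
  import Data.Integer.Properties as ℤP
  open import Data.Nat.Coprimality using (1-coprimeTo) renaming (sym to coprime-sym)
  import Data.Rational.Unnormalised as ℚᵘ
  import Data.Rational.Unnormalised.Properties as ℚᵘP
  open import Relation.Binary using (tri<; tri≈; tri>)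

  fromℕ : ℕ → ℚ
  fromℕ n = + n / 1

  fromℕ≡mkℚ : ∀ n → fromℕ n ≡ mkℚ (+ n) 0 (coprime-sym (1-coprimeTo n))
  fromℕ≡mkℚ n = ℚP.↥p/↧p≡p (mkℚ (+ n) 0 _)

  fromℕ-+ : ∀ m n → fromℕ (m ℕ.+ n) ≡ fromℕ m + fromℕ n
  fromℕ-+ m n rewrite fromℕ≡mkℚ m | fromℕ≡mkℚ n =
    ℚP./-cong (sym (cong₂ ℤ._+_ (ℤP.*-identityʳ (+ m)) (ℤP.*-identityʳ (+ n)))) refl

  fromℕ-* : ∀ m n → fromℕ (m ℕ.* n) ≡ fromℕ m * fromℕ n
  fromℕ-* m n rewrite fromℕ≡mkℚ m | fromℕ≡mkℚ n = ℚP./-cong (ℤP.pos-* m n) refl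

  frac-mono-< : ∀ {a b D} → 0 ℕ.< D → a ℕ.< b → frac a D < frac b D
  frac-mono-< {a} {b} {suc d} _ a<b =
    ℚP.toℚᵘ-cancel-< (ℚᵘP.<-respˡ-≃ (ℚᵘP.≃-sym (ℚP.toℚᵘ-fromℚᵘ (ℚᵘ.mkℚᵘ (+ a) d)))
                     (ℚᵘP.<-respʳ-≃ (ℚᵘP.≃-sym (ℚP.toℚᵘ-fromℚᵘ (ℚᵘ.mkℚᵘ (+ b) d)))
                     (ℚᵘ.*<* (ℤP.*-monoʳ-<-pos (+ suc d) (ℤ.+<+ a<b)))))

  frac-mono-≤ : ∀ {a b D} → 0 ℕ.< D → a ℕ.≤ b → frac a D ≤ frac b D
  frac-mono-≤ {a} {b} {suc d} _ a≤b =
    ℚP.toℚᵘ-cancel-≤ (ℚᵘP.≤-respˡ-≃ (ℚᵘP.≃-sym (ℚP.toℚᵘ-fromℚᵘ (ℚᵘ.mkℚᵘ (+ a) d)))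
                     (ℚᵘP.≤-respʳ-≃ (ℚᵘP.≃-sym (ℚP.toℚᵘ-fromℚᵘ (ℚᵘ.mkℚᵘ (+ b) d)))
                     (ℚᵘ.*≤* (ℤP.*-monoʳ-≤-nonNeg (+ suc d) (ℤ.+≤+ a≤b)))))

  fromℕ-nonNeg : ∀ n → 0ℚ ≤ fromℕ n
  fromℕ-nonNeg n = frac-mono-≤ {0} {n} {1} (s≤s z≤n) z≤n

  fromℕ-cancel-< : ∀ {m n} → fromℕ m < fromℕ n → m ℕ.< n
  fromℕ-cancel-< {m} {n} m<n with m ℕ.<? n
  ... | yes m<n = m<n
  ... | no  m≮n =
    contradiction (ℚP.<-≤-trans m<n (frac-mono-≤ {D = 1} (s≤s z≤n) (ℕP.≮⇒≥ m≮n))) (ℚP.<-irrefl refl)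

  *-nonNeg : ∀ {p q} → 0ℚ ≤ p → 0ℚ ≤ q → 0ℚ ≤ p * q
  *-nonNeg {p} {q} 0≤p 0≤q =
    ℚP.nonNegative⁻¹ _ {{ℚP.nonNeg*nonNeg⇒nonNeg p {{ℚ.nonNegative 0≤p}} q {{ℚ.nonNegative 0≤q}}}}

  *-pos : ∀ {p q} → 0ℚ < p → 0ℚ < q → 0ℚ < p * q
  *-pos {p} {q} 0<p 0<q = ℚP.positive⁻¹ _ {{ℚP.pos*pos⇒pos p {{ℚ.positive 0<p}} q {{ℚ.positive 0<q}}}}

  ^-nonNeg : ∀ {a} → 0ℚ ≤ a → ∀ m → 0ℚ ≤ a ^ℚ m
  ^-nonNeg 0≤a zero    = ℚP.nonNegative⁻¹ 1ℚ
  ^-nonNeg 0≤a (suc m) = *-nonNeg 0≤a (^-nonNeg 0≤a m)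

  ^-pos : ∀ {a} → 0ℚ < a → ∀ m → 0ℚ < a ^ℚ m
  ^-pos 0<a zero    = ℚP.positive⁻¹ 1ℚ
  ^-pos 0<a (suc m) = *-pos 0<a (^-pos 0<a m)

  *-monoˡ-≤-nonNeg : ∀ {r p q} → 0ℚ ≤ r → p ≤ q → r * p ≤ r * q
  *-monoˡ-≤-nonNeg {r} 0≤r = ℚP.*-monoˡ-≤-nonNeg r {{ℚ.nonNegative 0≤r}}

  *-monoʳ-≤-nonNeg : ∀ {r p q} → 0ℚ ≤ r → p ≤ q → p * r ≤ q * r
  *-monoʳ-≤-nonNeg {r} 0≤r = ℚP.*-monoʳ-≤-nonNeg r {{ℚ.nonNegative 0≤r}}

  *-monoʳ-<-pos : ∀ {r p q} → 0ℚ < r → p < q → p * r < q * r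
  *-monoʳ-<-pos {r} 0<r = ℚP.*-monoˡ-<-pos r {{ℚ.positive 0<r}}

  ≤-+-nonNeg : ∀ {p r} → 0ℚ ≤ r → p ≤ p + r
  ≤-+-nonNeg {p} 0≤r = subst (_≤ p + _) (ℚP.+-identityʳ p) (ℚP.+-monoʳ-≤ p 0≤r)

  bernoulli : ∀ {a δ} → 0ℚ ≤ a → 0ℚ ≤ δ → ∀ m → a ^ℚ m * (a + fromℕ (suc m) * δ) ≤ (a + δ) ^ℚ suc m
  bernoulli {a} {δ} _ _ zero =
    ℚP.≤-reflexive (solve 2 (λ a δ → con 1ℚ :* (a :+ con 1ℚ :* δ) := (a :+ δ) :* con 1ℚ) refl a δ)
    where open +-*-Solver
  bernoulli {a} {δ} 0≤a 0≤δ (suc m) = begin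
    a ^ℚ suc m * (a + fromℕ (suc (suc m)) * δ)
      ≡⟨ cong (λ s → a ^ℚ suc m * (a + s * δ)) (fromℕ-+ 1 (suc m)) ⟩
    (a * a ^ℚ m) * (a + (1ℚ + t) * δ)
      ≤⟨ ≤-+-nonNeg (*-nonNeg (*-nonNeg (*-nonNeg (^-nonNeg 0≤a m) (fromℕ-nonNeg (suc m))) 0≤δ) 0≤δ) ⟩
    (a * a ^ℚ m) * (a + (1ℚ + t) * δ) + a ^ℚ m * t * δ * δ
      ≡⟨ expand a δ (a ^ℚ m) t ⟨
    (a + δ) * (a ^ℚ m * (a + t * δ))
      ≤⟨ *-monoˡ-≤-nonNeg (ℚP.+-mono-≤ 0≤a 0≤δ) (bernoulli 0≤a 0≤δ m) ⟩
    (a + δ) * (a + δ) ^ℚ suc m ∎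
    where
    open ℚP.≤-Reasoning
    open +-*-Solver
    t = fromℕ (suc m)
    expand : ∀ a δ p t → (a + δ) * (p * (a + t * δ)) ≡ (a * p) * (a + (1ℚ + t) * δ) + p * t * δ * δ
    expand = solve 4 (λ a δ p t → (a :+ δ) :* (p :* (a :+ t :* δ))
                                := (a :* p) :* (a :+ (con 1ℚ :+ t) :* δ) :+ p :* t :* δ :* δ) refl

  <-fromℕ-suc∣↥∣ : ∀ z → z < fromℕ (suc ℤ.∣ ↥ z ∣)
  <-fromℕ-suc∣↥∣ (mkℚ n d _) rewrite fromℕ≡mkℚ (suc ℤ.∣ n ∣) =
    ℚ.*<* (subst₂ ℤ._<_ (sym (ℤP.*-identityʳ n)) (ℤP.pos-* (suc ℤ.∣ n ∣) (suc d)) (n<suc∣n∣*d n))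
    where
    n<suc∣n∣*d : ∀ n → n ℤ.< + (suc ℤ.∣ n ∣ ℕ.* suc d)
    n<suc∣n∣*d (+ k)     = ℤ.+<+ (ℕP.m≤m*n (suc k) (suc d))
    n<suc∣n∣*d -[1+ k ] = ℤ.-<+

  archimedean : ∀ y {x} → 0ℚ < x → ∃[ M ] y < fromℕ M * x
  archimedean y {x} 0<x =
    suc ℤ.∣ ↥ z ∣ , subst (_< fromℕ (suc ℤ.∣ ↥ z ∣) * x) z*x≡y (*-monoʳ-<-pos 0<x (<-fromℕ-suc∣↥∣ z))
    where
    instance
      x≢0 : ℚ.NonZero x
      x≢0 = ℚ.>-nonZero 0<x
    z = y * 1/ x
    z*x≡y : z * x ≡ y
    z*x≡y = trans (ℚP.*-assoc y (1/ x) x) (trans (cong (y *_) (ℚP.*-inverseˡ x)) (ℚP.*-identityʳ y))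

  eventually-dominated : ∀ {a b c D} → 0ℚ ≤ a → a < b → 0ℚ < c → 0ℚ ≤ D →
                         Eventually (λ m → a ^ℚ suc m + D * a ^ℚ m < c * b ^ℚ suc m)
  eventually-dominated {a} {b} {c} {D} 0≤a a<b 0<c 0≤D with ℚP.<-cmp 0ℚ a
  ... | tri> _ _ a<0 = contradiction (ℚP.<-≤-trans a<0 0≤a) (ℚP.<-irrefl refl)
  ... | tri≈ _ refl _ = 1 , λ { (suc m) _ → subst (_< c * b ^ℚ suc (suc m)) (sym (vanish D (0ℚ ^ℚ m)))
                                                   (*-pos 0<c (^-pos (ℚP.≤-<-trans 0≤a a<b) (suc (suc m)))) }
    where
    vanish : ∀ D p → 0ℚ * (0ℚ * p) + D * (0ℚ * p) ≡ 0ℚ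
    vanish = solve 2 (λ D p → con 0ℚ :* (con 0ℚ :* p) :+ D :* (con 0ℚ :* p) := con 0ℚ) refl
      where open +-*-Solver
  ... | tri< 0<a _ _ = M , dominated
    where
    δ = b - a
    0<δ : 0ℚ < δ
    0<δ = subst (_< δ) (ℚP.+-inverseʳ a) (ℚP.+-monoˡ-< (- a) a<b)
    0<cδ : 0ℚ < c * δ
    0<cδ = *-pos 0<c 0<δ
    M = proj₁ (archimedean (a + D) 0<cδ)
    dominated : ∀ m → M ℕ.≤ m → a ^ℚ suc m + D * a ^ℚ m < c * b ^ℚ suc m
    dominated m M≤m = begin-strict
      a ^ℚ suc m + D * a ^ℚ m
        ≡⟨ ℚP.*-distribʳ-+ (a ^ℚ m) a D ⟨
      (a + D) * a ^ℚ m
        <⟨ *-monoʳ-<-pos (^-pos 0<a m) a+D<c[a+tδ] ⟩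
      c * (a + t * δ) * a ^ℚ m
        ≡⟨ solve 5 (λ c a t δ p → c :* (a :+ t :* δ) :* p := c :* (p :* (a :+ t :* δ))) refl c a t δ (a ^ℚ m) ⟩
      c * (a ^ℚ m * (a + t * δ))
        ≤⟨ *-monoˡ-≤-nonNeg (ℚP.<⇒≤ 0<c) (bernoulli 0≤a (ℚP.<⇒≤ 0<δ) m) ⟩
      c * (a + δ) ^ℚ suc m
        ≡⟨ cong (λ x → c * x ^ℚ suc m) (solve 2 (λ a b → a :+ (b :- a) := b) refl a b) ⟩
      c * b ^ℚ suc m ∎
      where
      open ℚP.≤-Reasoning
      open +-*-Solver
      t = fromℕ (suc m)
      a+D<c[a+tδ] : a + D < c * (a + t * δ)
      a+D<c[a+tδ] = begin-strict
        a + D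
          <⟨ proj₂ (archimedean (a + D) 0<cδ) ⟩
        fromℕ M * (c * δ)
          ≤⟨ *-monoʳ-≤-nonNeg (ℚP.<⇒≤ 0<cδ) (frac-mono-≤ (s≤s z≤n) (ℕP.m≤n⇒m≤1+n M≤m)) ⟩
        t * (c * δ)
          ≤⟨ ≤-+-nonNeg (*-nonNeg (ℚP.<⇒≤ 0<c) 0≤a) ⟩
        t * (c * δ) + c * a
          ≡⟨ solve 4 (λ t c δ a → t :* (c :* δ) :+ c :* a := c :* (a :+ t :* δ)) refl t c δ a ⟩
        c * (a + t * δ) ∎

open import Data.Nat using (_+_; _*_; _≤_; _<_)

T-∧⁻ : ∀ {a b} → T (a ∧ b) → T a × T b
T-∧⁻ = Equivalence.to T-∧

T-∧⁺ : ∀ {a b} → T a × T b → T (a ∧ b)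
T-∧⁺ = Equivalence.from T-∧

T-∨⁻ : ∀ {a b} → T (a ∨ b) → T a ⊎ T b
T-∨⁻ = Equivalence.to T-∨

T-∨⁺ : ∀ {a b} → T a ⊎ T b → T (a ∨ b)
T-∨⁺ = Equivalence.from T-∨

¬T⇒T-not : ∀ {b} → ¬ T b → T (not b)
¬T⇒T-not {false} _  = _
¬T⇒T-not {true}  ¬t = ¬t _

not-mono : ∀ {a b} → (T a → T b) → T (not b) → T (not a)
not-mono {false}         _   _ = _
not-mono {true} {false}  a⇒b _ = a⇒b _

take-suc-∷ʳ : ∀ {A : Set} {x : A} {rest} r (l : List A) → drop r l ≡ x ∷ rest → take (suc r) l ≡ take r l ∷ʳ x
take-suc-∷ʳ zero    (y ∷ l) refl = refl
take-suc-∷ʳ (suc r) (y ∷ l) d    = cong (y ∷_) (take-suc-∷ʳ r l d)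

module _ {A : Set} where

  count : (A → Bool) → List A → ℕ
  count p xs = length (filter (λ x → p x ≟B true) xs)

  count-mono : ∀ {p q : A → Bool} xs → All (λ x → T (p x) → T (q x)) xs → count p xs ≤ count q xs
  count-mono []       []       = z≤n
  count-mono {p} {q} (x ∷ xs) (p⇒q ∷ h) with p x | q x | p⇒q
  ... | true  | true  | _   = s≤s (count-mono xs h)
  ... | true  | false | p⇒q = contradiction _ p⇒q
  ... | false | true  | _   = ℕP.m≤n⇒m≤1+n (count-mono xs h)
  ... | false | false | _   = count-mono xs h

  count-∨ : ∀ (p q : A → Bool) xs → count (λ x → p x ∨ q x) xs ≤ count p xs + count q xs
  count-∨ p q []       = z≤n
  count-∨ p q (x ∷ xs) with p x | q x
  ... | true  | true  = s≤s (ℕP.≤-trans (count-∨ p q xs) (ℕP.+-monoʳ-≤ (count p xs) (ℕP.n≤1+n _)))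
  ... | true  | false = s≤s (count-∨ p q xs)
  ... | false | true  = ℕP.≤-trans (s≤s (count-∨ p q xs)) (ℕP.≤-reflexive (sym (ℕP.+-suc (count p xs) _)))
  ... | false | false = count-∨ p q xs

  count-++ : ∀ (p : A → Bool) xs ys → count p (xs ++ ys) ≡ count p xs + count p ys
  count-++ p xs ys = trans (cong length (filter-++ (λ x → p x ≟B true) xs ys)) (length-++ (filter _ xs))

  count-concat : ∀ (p : A → Bool) xss → count p (concat xss) ≡ sum (map (count p) xss)
  count-concat p []         = refl
  count-concat p (xs ∷ xss) = trans (count-++ p xs (concat xss)) (cong (count p xs +_) (count-concat p xss))

  count-map : ∀ (p : A → Bool) (f : A → A) xs → count p (map f xs) ≡ count (p ∘ f) xs
  count-map p f []       = refl
  count-map p f (x ∷ xs) with p (f x)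
  ... | true  = cong suc (count-map p f xs)
  ... | false = count-map p f xs

  sum-map-*ˡ : ∀ c (f : A → ℕ) xs → sum (map (λ x → c * f x) xs) ≡ c * sum (map f xs)
  sum-map-*ˡ c f []       = sym (ℕP.*-zeroʳ c)
  sum-map-*ˡ c f (x ∷ xs) = trans (cong (c * f x +_) (sum-map-*ˡ c f xs)) (sym (ℕP.*-distribˡ-+ c (f x) _))

  sum-map-const : ∀ c (xs : List A) → sum (map (λ _ → c) xs) ≡ length xs * c
  sum-map-const c []       = refl
  sum-map-const c (x ∷ xs) = cong (c +_) (sum-map-const c xs)

module _ {σ : ℕ} where

  windows-∷ : ∀ {m} a (s : Str σ) → m ≤ length (a ∷ s) → windows m (a ∷ s) ≡ take m (a ∷ s) ∷ windows m s
  windows-∷ {m} a s m≤ with m ℕ.≤? length (a ∷ s)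
  ... | yes _  = refl
  ... | no m≰ = contradiction m≤ m≰

  windows-short : ∀ {m} (s : Str σ) → 1 ≤ m → length s < m → windows m s ≡ []
  windows-short {suc m} []      _ _   = refl
  windows-short {m}     (a ∷ s) _ s<m with m ℕ.≤? length (a ∷ s)
  ... | yes m≤ = contradiction m≤ (ℕP.<⇒≱ s<m)
  ... | no _   = refl

  ∈-windows⇒≤ : ∀ {m t} (s : Str σ) → t ∈ windows m s → m ≤ length s
  ∈-windows⇒≤ {zero}  s       _  = z≤n
  ∈-windows⇒≤ {suc m} []      ()
  ∈-windows⇒≤ {m}     (a ∷ s) t∈ with m ℕ.≤? length (a ∷ s)
  ... | yes m≤ = m≤

  take-∈-windows : ∀ {m} (s : Str σ) → m ≤ length s → take m s ∈ windows m s
  take-∈-windows {zero} []      _  = here refl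
  take-∈-windows        (a ∷ s) m≤ rewrite windows-∷ a s m≤ = here refl

  suffix-∷ : ∀ {m} a (s : Str σ) → m ≤ length s → suffix m (a ∷ s) ≡ suffix m s
  suffix-∷ a s m≤ = cong (λ n → drop n (a ∷ s)) (ℕP.+-∸-assoc 1 m≤)

  length-take≤ : ∀ m (s : Str σ) → length (take m s) ≤ m
  length-take≤ m s = ℕP.≤-trans (ℕP.≤-reflexive (length-take m s)) (ℕP.m⊓n≤m m _)

  windows-whole : ∀ {k} (v : Str σ) → 1 ≤ k → length v ≡ k → windows k v ≡ suffix k v ∷ []
  windows-whole (a ∷ s) 1≤k refl = begin
    windows (length (a ∷ s)) (a ∷ s)
      ≡⟨ windows-∷ a s ℕP.≤-refl ⟩
    take (length (a ∷ s)) (a ∷ s) ∷ windows (length (a ∷ s)) s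
      ≡⟨ cong₂ _∷_ (take-all _ (a ∷ s) ℕP.≤-refl) (windows-short s 1≤k ℕP.≤-refl) ⟩
    drop 0 (a ∷ s) ∷ []
      ≡⟨ cong (λ n → drop n (a ∷ s) ∷ []) (ℕP.n∸n≡0 (length (a ∷ s))) ⟨
    suffix (length (a ∷ s)) (a ∷ s) ∷ [] ∎
    where open ≡-Reasoning

  windows-take-∷ʳ : ∀ {k} m (v : Str σ) → length v ≡ suc m → 1 ≤ k → k ≤ suc m →
                    windows k v ≡ windows k (take m v) ∷ʳ suffix k v
  windows-take-∷ʳ zero (a ∷ []) _ (s≤s z≤n) (s≤s z≤n) = refl
  windows-take-∷ʳ {k} (suc m) (a ∷ s) |v| 1≤k k≤ with k ℕ.≤? suc m | ℕP.suc-injective |v|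
  ... | yes k≤m | |s| = begin
    windows k (a ∷ s)
      ≡⟨ windows-∷ a s (ℕP.m≤n⇒m≤1+n k≤s) ⟩
    take k (a ∷ s) ∷ windows k s
      ≡⟨ cong (take k (a ∷ s) ∷_) (windows-take-∷ʳ m s |s| 1≤k k≤m) ⟩
    take k (a ∷ s) ∷ windows k (take m s) ∷ʳ suffix k s
      ≡⟨ cong₂ (λ w u → w ∷ windows k (take m s) ∷ʳ u) take-prefix (sym (suffix-∷ a s k≤s)) ⟩
    take k (a ∷ take m s) ∷ windows k (take m s) ∷ʳ suffix k (a ∷ s)
      ≡⟨ cong (_∷ʳ suffix k (a ∷ s)) (windows-∷ a (take m s) k≤prefix) ⟨
    windows k (a ∷ take m s) ∷ʳ suffix k (a ∷ s) ∎
    where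
    open ≡-Reasoning
    k≤s : k ≤ length s
    k≤s = subst (k ≤_) (sym |s|) k≤m
    k≤prefix : k ≤ length (a ∷ take m s)
    k≤prefix = subst (k ≤_) (cong suc (sym (trans (length-take m s) (ℕP.m≤n⇒m⊓n≡m m≤s)))) k≤m
      where
      m≤s : m ≤ length s
      m≤s = subst (m ≤_) (sym |s|) (ℕP.n≤1+n m)
    take-prefix : take k (a ∷ s) ≡ take k (a ∷ take m s)
    take-prefix = trans (cong (λ n → take n (a ∷ s)) (sym (ℕP.m≤n⇒m⊓n≡m k≤m))) (sym (take-take k (suc m) (a ∷ s)))
  ... | no k≰m | |s| = begin
    windows k (a ∷ s)
      ≡⟨ windows-whole (a ∷ s) 1≤k (trans |v| (ℕP.≤-antisym m<k k≤)) ⟩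
    suffix k (a ∷ s) ∷ []
      ≡⟨ cong (_∷ʳ suffix k (a ∷ s)) (windows-short (a ∷ take m s) 1≤k (ℕP.≤-<-trans (s≤s (length-take≤ m s)) m<k)) ⟨
    windows k (a ∷ take m s) ∷ʳ suffix k (a ∷ s) ∎
    where
    open ≡-Reasoning
    m<k : suc m < k
    m<k = ℕP.≰⇒> k≰m

  ==⇒≡ : {s t : Str σ} → T (s == t) → s ≡ t
  ==⇒≡ = toWitness

  ≡⇒== : {s t : Str σ} → s ≡ t → T (s == t)
  ≡⇒== = fromWitness

  occurs⁺ : ∀ {t} (s : Str σ) → t ∈ windows (length t) s → T (occurs t s)
  occurs⁺ s t∈ = any⁺ _ (Any.map (λ t≡w → ≡⇒== (sym t≡w)) t∈)

  occurs⁻ : ∀ {t} (s : Str σ) → T (occurs t s) → t ∈ windows (length t) s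
  occurs⁻ s o = Any.map (λ w==t → sym (==⇒≡ w==t)) (any⁻ _ _ o)

  occurs⇒length≤ : ∀ {t} (s : Str σ) → T (occurs t s) → length t ≤ length s
  occurs⇒length≤ s o = ∈-windows⇒≤ s (occurs⁻ s o)

  occurs-prefix : ∀ {k t} (s : Str σ) → length t ≡ k → k ≤ length s → t ≡ take k s → T (occurs t s)
  occurs-prefix {t = t} s refl t≤s t≡ = occurs⁺ s (subst (_∈ windows (length t) s) (sym t≡) (take-∈-windows s t≤s))

  occurrences≡1⇒occurs : ∀ {t} (s : Str σ) → occurrences t s ≡ 1 → T (occurs t s)
  occurrences≡1⇒occurs {t} s once with filter (λ u → ≡-dec _≟F_ u t) (windows (length t) s) in eq
  ... | w ∷ _ with ∈-filter⁻ (λ u → ≡-dec _≟F_ u t) {xs = windows (length t) s} (subst (w ∈_) (sym eq) (here refl))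
  ... | w∈ , refl = occurs⁺ s w∈

  occurs-take⇒occurs : ∀ {t} m (v : Str σ) → length v ≡ suc m → 1 ≤ length t →
                       T (occurs t (take m v)) → T (occurs t v)
  occurs-take⇒occurs {t} m v |v| 1≤t o =
    occurs⁺ v (subst (t ∈_) (sym (windows-take-∷ʳ m v |v| 1≤t t≤)) (∈-++⁺ˡ (occurs⁻ (take m v) o)))
    where
    t≤ : length t ≤ suc m
    t≤ = ℕP.m≤n⇒m≤1+n (ℕP.≤-trans (occurs⇒length≤ (take m v) o) (length-take≤ m v))

  unique-suffix⇒¬occurs-take : ∀ {k x} m (v : Str σ) → length v ≡ suc m → length x ≡ k → 1 ≤ k → k ≤ suc m →
                               x ≡ suffix k v → occurrences x v ≡ 1 → ¬ T (occurs x (take m v))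
  unique-suffix⇒¬occurs-take {x = x} m v |v| refl 1≤x x≤ x≡ once o =
    ℕP.<-irrefl (sym once)
      (subst (1 <_) (sym occurrences≡) (ℕP.+-monoˡ-< 1 (filter-some _≟x (Any.map sym (occurs⁻ (take m v) o)))))
    where
    open ≡-Reasoning
    _≟x = λ (u : Str σ) → ≡-dec _≟F_ u x
    ws = windows (length x) (take m v)
    occurrences≡ : occurrences x v ≡ length (filter _≟x ws) + 1
    occurrences≡ = begin
      occurrences x v
        ≡⟨ cong (λ us → length (filter _≟x us)) (windows-take-∷ʳ m v |v| 1≤x x≤) ⟩
      length (filter _≟x (ws ∷ʳ suffix (length x) v))
        ≡⟨ cong length (filter-++ _≟x ws _) ⟩
      length (filter _≟x ws ++ filter _≟x (suffix (length x) v ∷ []))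
        ≡⟨ length-++ (filter _≟x ws) ⟩
      length (filter _≟x ws) + length (filter _≟x (suffix (length x) v ∷ []))
        ≡⟨ cong (λ us → length (filter _≟x ws) + length us) (filter-accept _≟x (sym x≡)) ⟩
      length (filter _≟x ws) + 1 ∎

  avoidsAll-prefix : ∀ {ts} m (v : Str σ) → length v ≡ suc m → All (λ t → 1 ≤ length t) ts →
                     T (avoidsAll ts v) → T (avoidsAll ts (take m v))
  avoidsAll-prefix m v |v| nonempty av =
    all⁻ (λ t → not (occurs t (take m v)))
      (All.zipWith (λ (1≤t , ¬o) → not-mono (occurs-take⇒occurs m v |v| 1≤t) ¬o) (nonempty , all⁺ _ _ av))

  avoidsAll-∷ʳ : ∀ {ts x} (v : Str σ) → T (avoidsAll ts v) → ¬ T (occurs x v) → T (avoidsAll (ts ∷ʳ x) v)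
  avoidsAll-∷ʳ {ts} v av ¬o = all⁻ (λ t → not (occurs t v)) (∷ʳ⁺ (all⁺ _ ts av) (¬T⇒T-not ¬o))

  avoidsAll-take-≤ : ∀ {j r} (l : List (Str σ)) (v : Str σ) → j ≤ r →
                     T (avoidsAll (take r l) v) → T (avoidsAll (take j l) v)
  avoidsAll-take-≤ {j} {r} l v j≤r av =
    all⁻ (λ t → not (occurs t v))
      (subst (All _) (trans (take-take j r l) (cong (λ n → take n l) (ℕP.m≤n⇒m⊓n≡m j≤r))) (take⁺ j (all⁺ _ _ av)))

  -- x has rank r + 1 in l when drop r l ≡ x ∷ rest.
  minKmer-rank : ∀ (l : List (Str σ)) (v : Str σ) {x} → minKmer l v ≡ just x →
                 ∃[ r ] ∃[ rest ] (drop r l ≡ x ∷ rest × T (avoidsAll (take r l) v) × T (occurs x v))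
  minKmer-rank (y ∷ l) v eq with occurs y v in oy
  minKmer-rank (y ∷ l) v refl | true  = 0 , l , refl , _ , subst T (sym oy) _
  ... | false with r , rest , d , av , o ← minKmer-rank l v eq =
    suc r , rest , d , T-∧⁺ (subst (T ∘ not) (sym oy) _ , av) , o

  minKmer-of-rank : ∀ r (l : List (Str σ)) (v : Str σ) {x rest} → drop r l ≡ x ∷ rest →
                    T (avoidsAll (take r l) v) → T (occurs x v) → minKmer l v ≡ just x
  minKmer-of-rank zero    (x ∷ l) v refl _  o with occurs x v
  ... | true = refl
  minKmer-of-rank (suc r) (y ∷ l) v d    av o with occurs y v
  ... | false = minKmer-of-rank r l v d av o

module _ {σ k : ℕ} (ρ : Arrangement σ k) where

  drop-of-entry : ∀ {r x} → entry ρ (suc r) ≡ just x → ∃[ rest ] drop r (seq ρ) ≡ x ∷ rest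
  drop-of-entry {r} e with drop r (seq ρ)
  drop-of-entry refl | x ∷ rest = rest , refl

  length-of-drop : ∀ r {x rest} → drop r (seq ρ) ≡ x ∷ rest → length x ≡ k
  length-of-drop r d = All.head (subst (All _) d (drop⁺ r (kmers ρ)))

  𝓟-intro : ∀ r {x rest v} → drop r (seq ρ) ≡ x ∷ rest → k ≤ length v → x ≡ take k v →
            T (avoidsAll (firsts ρ r) v) → T (𝓟 ρ (suc r) v)
  𝓟-intro r {v = v} d k≤v x≡ av rewrite d =
    T-∧⁺ (fromWitness {a? = k ℕ.≤? length v} k≤v , T-∧⁺ (≡⇒== (sym x≡) , av))

  𝓟-elim : ∀ r {v} → T (𝓟 ρ (suc r) v) →
           ∃[ x ] ∃[ rest ] (drop r (seq ρ) ≡ x ∷ rest × k ≤ length v × x ≡ take k v × T (avoidsAll (firsts ρ r) v))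
  𝓟-elim r {v} h with entry ρ (suc r) in e
  ... | just x =
    let rest , d = drop-of-entry {r} e
        k≤v , h′ = T-∧⁻ h
        x≡ , av = T-∧⁻ h′
    in x , rest , d , toWitness {a? = k ℕ.≤? length v} k≤v , sym (==⇒≡ x≡) , av

  𝓢-intro : ∀ r {x rest v} → drop r (seq ρ) ≡ x ∷ rest → k ≤ length v → x ≡ suffix k v → occurrences x v ≡ 1 →
            T (avoidsAll (firsts ρ r) v) → T (𝓢 ρ (suc r) v)
  𝓢-intro r {x = x} {v = v} d k≤v x≡ once av rewrite d =
    T-∧⁺ (fromWitness {a? = k ℕ.≤? length v} k≤v ,
          T-∧⁺ (≡⇒== (sym x≡) , T-∧⁺ (fromWitness {a? = occurrences x v ℕ.≟ 1} once , av)))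

  𝓢-elim : ∀ r {v} → T (𝓢 ρ (suc r) v) →
           ∃[ x ] ∃[ rest ] (drop r (seq ρ) ≡ x ∷ rest × x ≡ suffix k v × occurrences x v ≡ 1 ×
                             T (avoidsAll (firsts ρ r) v))
  𝓢-elim r {v} h with entry ρ (suc r) in e
  ... | just x =
    let rest , d = drop-of-entry {r} e
        _ , h′ = T-∧⁻ {⌊ k ℕ.≤? length v ⌋} h
        x≡ , h″ = T-∧⁻ h′
        once , av = T-∧⁻ h″
    in x , rest , d , sym (==⇒≡ x≡) , toWitness {a? = occurrences x v ℕ.≟ 1} once , av

  charged-of-minKmer : ∀ {v x} → minKmer (seq ρ) v ≡ just x →
                       T ((x == take k v) ∨ ((x == suffix k v) ∧ ⌊ occurrences x v ℕ.≟ 1 ⌋)) → T (charged ρ v)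
  charged-of-minKmer mk h rewrite mk = h

  𝓟⇒charged : ∀ r {v} → T (𝓟 ρ (suc r) v) → T (charged ρ v)
  𝓟⇒charged r {v} h =
    let x , _ , d , k≤v , x≡ , av = 𝓟-elim r h
    in charged-of-minKmer (minKmer-of-rank r (seq ρ) v d av (occurs-prefix v (length-of-drop r d) k≤v x≡))
                          (T-∨⁺ (inj₁ (≡⇒== x≡)))

  𝓢⇒charged : ∀ r {v} → T (𝓢 ρ (suc r) v) → T (charged ρ v)
  𝓢⇒charged r {v} h =
    let x , _ , d , x≡ , once , av = 𝓢-elim r h
    in charged-of-minKmer (minKmer-of-rank r (seq ρ) v d av (occurrences≡1⇒occurs v once))
                          (T-∨⁺ (inj₂ (T-∧⁺ (≡⇒== x≡ , fromWitness once))))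

  𝓦⇒charged : ∀ {i v} → T (𝓦 ρ i v) → T (charged ρ v)
  𝓦⇒charged {i} {v} h with T-∨⁻ {any (λ j → 𝓟 ρ (suc j) v) (upTo (suc i))} h
  ... | inj₁ p = let r , h′ = Any.satisfied (any⁻ (λ j → 𝓟 ρ (suc j) v) (upTo (suc i)) p) in 𝓟⇒charged r h′
  ... | inj₂ s = let r , h′ = Any.satisfied (any⁻ (λ j → 𝓢 ρ (suc j) v) (upTo i) s) in 𝓢⇒charged r h′

  𝓟⇒𝓦 : ∀ {r i v} → r ≤ i → T (𝓟 ρ (suc r) v) → T (𝓦 ρ i v)
  𝓟⇒𝓦 {v = v} r≤i h = T-∨⁺ (inj₁ (any⁺ (λ j → 𝓟 ρ (suc j) v) (lose (∈-upTo⁺ (s≤s r≤i)) h)))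

  𝓢⇒𝓦 : ∀ {r i v} → r < i → T (𝓢 ρ (suc r) v) → T (𝓦 ρ i v)
  𝓢⇒𝓦 {i = i} {v} r<i h =
    T-∨⁺ {any (λ j → 𝓟 ρ (suc j) v) (upTo (suc i))} (inj₂ (any⁺ (λ j → 𝓢 ρ (suc j) v) (lose (∈-upTo⁺ r<i) h)))

  charged⇒rank : ∀ {v} → T (charged ρ v) →
                 ∃[ r ] ∃[ x ] ∃[ rest ] (drop r (seq ρ) ≡ x ∷ rest × T (avoidsAll (firsts ρ r) v) × k ≤ length v ×
                                          (x ≡ take k v ⊎ (x ≡ suffix k v × occurrences x v ≡ 1)))
  charged⇒rank {v} ch with minKmer (seq ρ) v in mk
  ... | just x with r , rest , d , av , ox ← minKmer-rank (seq ρ) v mk =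
    r , x , rest , d , av , k≤v ,
    Sum.map ==⇒≡ (λ h → let x≡ , once = T-∧⁻ h in ==⇒≡ x≡ , toWitness once) (T-∨⁻ ch)
    where
    k≤v : k ≤ length v
    k≤v = subst (_≤ length v) (length-of-drop r d) (occurs⇒length≤ v ox)

  𝓛-take-of-unique-suffix : 1 ≤ k → ∀ m r {x rest v} → length v ≡ suc m → drop r (seq ρ) ≡ x ∷ rest →
                            T (avoidsAll (firsts ρ r) v) → k ≤ length v → x ≡ suffix k v → occurrences x v ≡ 1 →
                            T (𝓛 ρ (suc r) (take m v))
  𝓛-take-of-unique-suffix 1≤k m r {v = v} |v| d av k≤v x≡ once =
    subst (λ ts → T (avoidsAll ts (take m v))) (sym (take-suc-∷ʳ r (seq ρ) d))
      (avoidsAll-∷ʳ {ts = firsts ρ r} (take m v) (avoidsAll-prefix m v |v| nonempty av)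
        (unique-suffix⇒¬occurs-take m v |v| (length-of-drop r d) 1≤k (subst (k ≤_) |v| k≤v) x≡ once))
    where
    nonempty : All (λ t → 1 ≤ length t) (firsts ρ r)
    nonempty = All.map (λ |t| → ℕP.≤-trans 1≤k (ℕP.≤-reflexive (sym |t|))) (take⁺ r (kmers ρ))

  charged-cover : 1 ≤ k → ∀ i m {v} → length v ≡ suc m → T (charged ρ v) →
                  T (𝓦 ρ i v) ⊎ T (𝓛 ρ (suc i) v) ⊎ T (𝓛 ρ (suc i) (take m v))
  charged-cover 1≤k i m {v} |v| ch with charged⇒rank ch
  ... | r , x , rest , d , av , k≤v , pos with i ℕ.<? r | pos
  ...   | yes i<r | _               = inj₂ (inj₁ (avoidsAll-take-≤ (seq ρ) v i<r av))
  ...   | no i≮r  | inj₁ x≡         = inj₁ (𝓟⇒𝓦 (ℕP.≮⇒≥ i≮r) (𝓟-intro r d k≤v x≡ av))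
  ...   | no i≮r  | inj₂ (x≡ , once) with ℕP.m≤n⇒m<n∨m≡n (ℕP.≮⇒≥ i≮r)
  ...     | inj₁ r<i  = inj₁ (𝓢⇒𝓦 r<i (𝓢-intro r d k≤v x≡ once av))
  ...     | inj₂ refl = inj₂ (inj₂ (𝓛-take-of-unique-suffix 1≤k m r |v| d av k≤v x≡ once))

module _ {σ : ℕ} where

  allStrings-length : ∀ n → All (λ v → length v ≡ n) (allStrings σ n)
  allStrings-length zero    = refl ∷ []
  allStrings-length (suc n) =
    concat⁺ (map⁺ (All.universal (λ a → map⁺ (All.map (cong suc) (allStrings-length n))) (allFin σ)))

  count-allStrings-suc : ∀ (p : Str σ → Bool) n →
    count p (allStrings σ (suc n)) ≡ sum (map (λ a → count (p ∘ (a ∷_)) (allStrings σ n)) (allFin σ))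
  count-allStrings-suc p n = begin
    count p (concat (map extend (allFin σ)))
      ≡⟨ count-concat p (map extend (allFin σ)) ⟩
    sum (map (count p) (map extend (allFin σ)))
      ≡⟨ cong sum (map-∘ (allFin σ)) ⟨
    sum (map (count p ∘ extend) (allFin σ))
      ≡⟨ cong sum (map-cong (λ a → count-map p (a ∷_) (allStrings σ n)) (allFin σ)) ⟩
    sum (map (λ a → count (p ∘ (a ∷_)) (allStrings σ n)) (allFin σ)) ∎
    where
    open ≡-Reasoning
    extend : Fin σ → List (Str σ)
    extend a = map (a ∷_) (allStrings σ n)

  count-take-allStrings : ∀ m (p : Str σ → Bool) →
                          count (p ∘ take m) (allStrings σ (suc m)) ≡ σ * count p (allStrings σ m)
  count-take-allStrings zero p = begin
    count (p ∘ take 0) (allStrings σ 1)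
      ≡⟨ count-allStrings-suc (p ∘ take 0) 0 ⟩
    sum (map (λ a → count (λ _ → p []) (allStrings σ 0)) (allFin σ))
      ≡⟨ cong sum (map-cong (λ _ → count-[[]]) (allFin σ)) ⟩
    sum (map (λ _ → count p (allStrings σ 0)) (allFin σ))
      ≡⟨ sum-map-const _ (allFin σ) ⟩
    length (allFin σ) * count p (allStrings σ 0)
      ≡⟨ cong (_* count p (allStrings σ 0)) (length-tabulate {n = σ} id) ⟩
    σ * count p (allStrings σ 0) ∎
    where
    open ≡-Reasoning
    count-[[]] : count (λ _ → p []) (allStrings σ 0) ≡ count p (allStrings σ 0)
    count-[[]] with p []
    ... | true  = refl
    ... | false = refl
  count-take-allStrings (suc m) p = begin
    count (p ∘ take (suc m)) (allStrings σ (suc (suc m)))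
      ≡⟨ count-allStrings-suc (p ∘ take (suc m)) (suc m) ⟩
    sum (map (λ a → count (p ∘ (a ∷_) ∘ take m) (allStrings σ (suc m))) (allFin σ))
      ≡⟨ cong sum (map-cong (λ a → count-take-allStrings m (p ∘ (a ∷_))) (allFin σ)) ⟩
    sum (map (λ a → σ * count (p ∘ (a ∷_)) (allStrings σ m)) (allFin σ))
      ≡⟨ sum-map-*ˡ σ _ (allFin σ) ⟩
    σ * sum (map (λ a → count (p ∘ (a ∷_)) (allStrings σ m)) (allFin σ))
      ≡⟨ cong (σ *_) (count-allStrings-suc p m) ⟨
    σ * count p (allStrings σ (suc m)) ∎
    where open ≡-Reasoning

module _ {σ k : ℕ} where

  C-𝓦≤C-charged : (π : Arrangement σ k) → ∀ j n → C (𝓦 π j) n ≤ C (charged π) n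
  C-𝓦≤C-charged π j n = count-mono (allStrings σ n) (All.universal (λ _ → 𝓦⇒charged π {j}) _)

  C-charged≤ : 1 ≤ k → (ρ : Arrangement σ k) → ∀ i m →
               C (charged ρ) (suc m) ≤ C (𝓦 ρ i) (suc m) + (C (𝓛 ρ (suc i)) (suc m) + σ * C (𝓛 ρ (suc i)) m)
  C-charged≤ 1≤k ρ i m = begin
    count (charged ρ) vs
      ≤⟨ count-mono vs (All.map (λ |v| → cover |v|) (allStrings-length (suc m))) ⟩
    count (λ v → W v ∨ (L v ∨ L (take m v))) vs
      ≤⟨ count-∨ W _ vs ⟩
    count W vs + count (λ v → L v ∨ L (take m v)) vs
      ≤⟨ ℕP.+-monoʳ-≤ (count W vs) (count-∨ L (L ∘ take m) vs) ⟩
    count W vs + (count L vs + count (L ∘ take m) vs)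
      ≡⟨ cong (λ c → count W vs + (count L vs + c)) (count-take-allStrings m L) ⟩
    count W vs + (count L vs + σ * count L (allStrings σ m)) ∎
    where
    open ℕP.≤-Reasoning
    vs = allStrings σ (suc m)
    W = 𝓦 ρ i
    L = 𝓛 ρ (suc i)
    cover : ∀ {v} → length v ≡ suc m → T (charged ρ v) → T (W v ∨ (L v ∨ L (take m v)))
    cover |v| = T-∨⁺ ∘ Sum.map₂ T-∨⁺ ∘ charged-cover ρ 1≤k i m |v|

  C-charged-gap : 1 ≤ k → (π ρ : Arrangement σ k) → ∀ i j m {β β′ c} →
                  fromℕ (C (𝓛 ρ (suc i)) (suc m)) ℚ.≤ β′ ^ℚ suc m →
                  fromℕ (C (𝓛 ρ (suc i)) m) ℚ.≤ β′ ^ℚ m →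
                  β′ ^ℚ suc m ℚ.+ fromℕ σ ℚ.* β′ ^ℚ m ℚ.< c ℚ.* β ^ℚ suc m →
                  c ℚ.* β ^ℚ suc m ℚ.≤ diffW π j ρ i (suc m) →
                  C (charged ρ) (suc m) < C (charged π) (suc m)
  C-charged-gap 1≤k π ρ i j m {β} {β′} {c} L₁≤ L₀≤ dominated Ω =
    ℕP.≤-<-trans (C-charged≤ 1≤k ρ i m) (ℕP.<-≤-trans (fromℕ-cancel-< budget) (C-𝓦≤C-charged π j (suc m)))
    where
    open ℚP.≤-Reasoning
    open +-*-Solver
    X = C (𝓦 π j) (suc m)
    Y = C (𝓦 ρ i) (suc m)
    A = C (𝓛 ρ (suc i)) (suc m)
    B = C (𝓛 ρ (suc i)) m
    budget : fromℕ (Y + (A + σ * B)) ℚ.< fromℕ X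
    budget = begin-strict
      fromℕ (Y + (A + σ * B))
        ≡⟨ trans (fromℕ-+ Y _) (cong (fromℕ Y ℚ.+_) (trans (fromℕ-+ A _) (cong (fromℕ A ℚ.+_) (fromℕ-* σ B)))) ⟩
      fromℕ Y ℚ.+ (fromℕ A ℚ.+ fromℕ σ ℚ.* fromℕ B)
        ≤⟨ ℚP.+-monoʳ-≤ (fromℕ Y) (ℚP.+-mono-≤ L₁≤ (*-monoˡ-≤-nonNeg (fromℕ-nonNeg σ) L₀≤)) ⟩
      fromℕ Y ℚ.+ (β′ ^ℚ suc m ℚ.+ fromℕ σ ℚ.* β′ ^ℚ m)
        <⟨ ℚP.+-monoʳ-< (fromℕ Y) dominated ⟩
      fromℕ Y ℚ.+ c ℚ.* β ^ℚ suc m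
        ≤⟨ ℚP.+-monoʳ-≤ (fromℕ Y) Ω ⟩
      fromℕ Y ℚ.+ (fromℕ X ℚ.- fromℕ Y)
        ≡⟨ solve 2 (λ y x → y :+ (x :- y) := x) refl (fromℕ Y) (fromℕ X) ⟩
      fromℕ X ∎

  eventually-C-charged-gap : 1 ≤ k → (π ρ : Arrangement σ k) → ∀ i j {β β′ c} →
                             0ℚ ℚ.≤ β′ → β′ ℚ.< β → 0ℚ ℚ.< c →
                             Eventually (λ n → fromℕ (C (𝓛 ρ (suc i)) n) ℚ.≤ β′ ^ℚ n) →
                             Eventually (λ n → c ℚ.* β ^ℚ n ℚ.≤ diffW π j ρ i n) →
                             Eventually (λ m → C (charged ρ) (suc m) < C (charged π) (suc m))
  eventually-C-charged-gap 1≤k π ρ i j {β} {β′} {c} 0≤β′ β′<β 0<c growth Ω =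
    eventually-mono (λ m (L₁≤ , L₀≤ , dominated , Ω′) →
                       C-charged-gap 1≤k π ρ i j m {β} {β′} {c} L₁≤ L₀≤ dominated Ω′)
      (eventually-× (eventually-suc growth)
        (eventually-× growth
          (eventually-× (eventually-dominated 0≤β′ β′<β 0<c (fromℕ-nonNeg σ)) (eventually-suc Ω))))

◁-from-C-charged-gap : ∀ {σ k} .{{_ : ℕ.NonZero σ}} (π ρ : Arrangement σ (suc k)) →
                       Eventually (λ m → C (charged ρ) (suc m) < C (charged π) (suc m)) → ρ ◁ π
◁-from-C-charged-gap {σ} {k} π ρ (N , gap) = N , λ w N≤w →
  frac-mono-< (ℕP.m^n>0 σ (w + suc k))
    (subst (λ n → C (charged ρ) n < C (charged π) n) (sym (ℕP.+-suc w k))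
      (gap (w + k) (ℕP.≤-trans N≤w (ℕP.m≤m+n w k))))

lemma10 : (σ k : ℕ) → 2 ≤ σ → 2 ≤ k → (π ρ : Arrangement σ k) → InU π → InU ρ →
    (∃[ i ] ∃[ j ] ∃[ β ] (i < size ρ × j < size π ×
       GrowthBelow (𝓛 ρ (suc i)) β × BigΩPow (diffW π j ρ i) β)) →
    ρ ◁ π
lemma10 (suc σ) (suc k) (s≤s _) (s≤s _) π ρ _ _
        (i , j , β , _ , _ , (β′ , 0≤β′ , β′<β , growth) , (c , 0<c , Ω)) =
  ◁-from-C-charged-gap π ρ (eventually-C-charged-gap (s≤s z≤n) π ρ i j 0≤β′ β′<β 0<c growth Ω)
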